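{- For every integer $t \ge 2$ there is a constant $C = C(t)$ such that, if $n$ is large enough, then every $2$-edge-coloring $E(K_n) = E(R)\cup E(B)$ with $\min\{e(R),e(B)\} \ge Cn$ contains an induced monochromatic member of $\{K_{1,BR(t)}, S_{t,t}\}$; in particular, it contains an induced monochromatic star $K_{1,t}$.
   Context: A $2$-edge-coloring of $K_n$ is a partition $E(K_n) = E(R)\cup E(B)$ into red and blue edges; $e(R),e(B)$ are the numbers of red and blue edges. The coloring contains an induced monochromatic copy of a graph $H$ if there is $U\subseteq V(K_n)$ with $|U|=|V(H)|$ such that the red edges inside $U$, or the blue edges inside $U$, form a graph isomorphic to $H$. $K_{1,m}$ is the star with $m$ leaves; $S_{t,t}$ is the complete split graph consisting of a clique on $t$ vertices, an independent set on $t$ vertices, and all edges between them. $BR(t)$ is the smallest integer such that every $2$-edge-coloring of $K_{m,m}$ with $m\ge BR(t)$ contains a monochromatic $K_{t,t}$. -}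

module Defs where

open import Data.Nat using (ℕ; zero; suc; _+_; _*_; _≤_; _<ᵇ_)
open import Data.Bool using (Bool; true; false; not; _∧_; _∨_; if_then_else_)
open import Data.Fin using (Fin; toℕ)
open import Data.List using (List; map; allFin)
open import Data.Nat.ListAction using (sum)
open import Data.Product using (Σ; _×_; ∃; ∃-syntax)
open import Relation.Binary.PropositionalEquality using (_≡_; _≢_)
open import Function.Definitions using (Injective)

-- A 2-edge-coloring of K_n: c i j = true means the edge ij is red,
-- false means blue. Only values with i ≢ j matter; c must be symmetric.
Coloring : ℕ → Set
Coloring n = Fin n → Fin n → Bool

Symmetric : {n : ℕ} → Coloring n → Set
Symmetric {n} c = ∀ (i j : Fin n) → c i j ≡ c j i

numEdges : {n : ℕ} → Coloring n → Bool → ℕ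
numEdges {n} c col =
  sum (map (λ i → sum (map (λ j →
    if (toℕ i <ᵇ toℕ j) ∧ (if col then c i j else not (c i j)) then 1 else 0)
    (allFin n))) (allFin n))

eR : {n : ℕ} → Coloring n → ℕ
eR c = numEdges c true

eB : {n : ℕ} → Coloring n → ℕ
eB c = numEdges c false

-- A (simple) graph on vertex set Fin k, given by a Boolean adjacency
-- relation (only the values on distinct vertices are used).
Graph : ℕ → Set
Graph k = Fin k → Fin k → Bool

InducedMono : {n k : ℕ} → Coloring n → Graph k → Set
InducedMono {n} {k} c H =
  Σ Bool λ col → Σ (Fin k → Fin n) λ f → Injective _≡_ _≡_ f ×
    (∀ (a b : Fin k) → a ≢ b →
       c (f a) (f b) ≡ (if H a b then col else not col))

isZero : {k : ℕ} → Fin k → Bool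
isZero Fin.zero = true
isZero (Fin.suc _) = false

-- the star K_{1,m}: vertex 0 is the centre, vertices 1..m are leaves
Star : (m : ℕ) → Graph (suc m)
Star m a b = (isZero a ∧ not (isZero b)) ∨ (not (isZero a) ∧ isZero b)

-- the complete split graph S_{t,t}: vertices 0..t-1 form a clique,
-- vertices t..2t-1 an independent set, all edges between them present
Split : (t : ℕ) → Graph (t + t)
Split t a b = (toℕ a <ᵇ t) ∨ (toℕ b <ᵇ t)

-- 2-edge-colorings of K_{m,m}: d x y is the colour of the edge between
-- vertex x of the first part and vertex y of the second part
BipColoring : ℕ → Set
BipColoring m = Fin m → Fin m → Bool

HasMonoKtt : {m : ℕ} → ℕ → BipColoring m → Set
HasMonoKtt {m} t d =
  Σ Bool λ col → Σ (Fin t → Fin m) λ f → Σ (Fin t → Fin m) λ g →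
    Injective _≡_ _≡_ f × Injective _≡_ _≡_ g ×
    (∀ (a b : Fin t) → d (f a) (g b) ≡ col)

BRProperty : ℕ → ℕ → Set
BRProperty t b = ∀ (m : ℕ) → b ≤ m → (d : BipColoring m) → HasMonoKtt t d

IsBR : ℕ → ℕ → Set
IsBR t b = BRProperty t b × (∀ b′ → BRProperty t b′ → b ≤ b′)

{-# OPTIONS --safe #-}
module Submission where

-- In fact every colouring with at least C(s)·n edges of each colour contains an
-- induced monochromatic star K_{1,s}, for every s; with s ≥ BR(t) this gives both
-- conclusions.
-- A vertex of large red degree has, by Ramsey's theorem in its red neighbourhood,
-- either s pairwise blue red neighbours (an induced red star) or a red clique K of
-- size s² + 1; likewise a vertex of large blue degree yields an induced blue star
-- or a blue clique Q of size s.  If no vertex of Q has s blue neighbours in K, then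
-- discarding those neighbours (and q itself) for each q ∈ Q costs at most s·|Q| < |K|
-- vertices and leaves a vertex of K red to all of Q: the centre of an induced red
-- star with leaves Q.  The bound BR(t) ≤ t·4^t + 2t comes from the bipartite
-- analogue of the Erdős–Szekeres recursion.

open import Defs
open import Data.Nat using (ℕ; zero; suc; _+_; _*_; _^_; _≤_; _<_; _<ᵇ_; z≤n; s≤s; _≤?_; >-nonZero)
open import Data.Nat.Properties
open import Data.Nat.ListAction using (sum)
open import Data.Bool using (Bool; true; false; not; _∧_; if_then_else_; T)
open import Data.Bool.Properties using (T?; T-∧; ¬-not; not-involutive) renaming (_≟_ to _≟ᵇ_)
open import Data.Fin using (Fin; toℕ; inject≤) renaming (_≟_ to _≟ᶠ_)
open import Data.Fin.Properties using (inject≤-injective)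
open import Data.List using (List; []; _∷_; length; map; filter; lookup; allFin)
open import Data.List.Properties using (length-tabulate; filter-all)
open import Data.List.Membership.Propositional using (_∈_)
open import Data.List.Membership.Propositional.Properties using (∈-lookup; ∈-filter⁻)
open import Data.List.Relation.Unary.All as All using (All; []; _∷_)
open import Data.List.Relation.Unary.Any using (here)
open import Data.List.Relation.Unary.All.Properties using (all-filter)
open import Data.List.Relation.Unary.AllPairs as AllPairs using (AllPairs; []; _∷_)
import Data.List.Relation.Unary.AllPairs.Properties as AllPairs
open import Data.List.Relation.Unary.Unique.Propositional using (Unique)
open import Data.List.Relation.Unary.Unique.Propositional.Properties using (allFin⁺)
open import Data.List.Relation.Binary.Sublist.Propositional using (_⊆_; []; _∷_; _∷ʳ_; ⊆-refl; ⊆-trans; minimum)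
open import Data.List.Relation.Binary.Sublist.Propositional.Properties using (All-resp-⊆; filter-⊆)
open import Data.Product using (Σ; ∃; _×_; _,_; proj₁; proj₂)
open import Data.Sum using (_⊎_; inj₁; inj₂)
open import Function using (_∘_; Injective; Equivalence)
open import Relation.Binary using (Rel; DecidableEquality)
import Relation.Binary as B
open import Relation.Binary.PropositionalEquality
open import Relation.Nullary using (yes; no; ¬?; contradiction)
open import Relation.Unary using (Decidable)
open import Relation.Unary.Properties using (∁?)
open import Level using (0ℓ)

length-allFin : (m : ℕ) → length (allFin m) ≡ m
length-allFin m = length-tabulate (λ (i : Fin m) → i)

module _ {A : Set} where

  length-filter-∁ : {P : A → Set} (P? : Decidable P) (xs : List A) →
                    length (filter P? xs) + length (filter (∁? P?) xs) ≡ length xs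
  length-filter-∁ P? [] = refl
  length-filter-∁ P? (x ∷ xs) with P? x
  ... | yes _ = cong suc (length-filter-∁ P? xs)
  ... | no _  = trans (+-suc _ _) (cong suc (length-filter-∁ P? xs))

  pigeonhole-filter : {P : A → Set} (P? : Decidable P) (xs : List A) {p q : ℕ} →
                      p + q ≤ length xs →
                      q ≤ length (filter (∁? P?) xs) ⊎ p < length (filter P? xs)
  pigeonhole-filter P? xs {p} {q} p+q≤ with q ≤? length (filter (∁? P?) xs)
  ... | yes q≤ = inj₁ q≤
  ... | no q≰ = inj₂ (+-cancelʳ-< (length (filter (∁? P?) xs)) p _ (begin-strict
        p + length (filter (∁? P?) xs)              <⟨ +-monoʳ-< p (≰⇒> q≰) ⟩
        p + q                                       ≤⟨ p+q≤ ⟩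
        length xs                                   ≡⟨ sym (length-filter-∁ P? xs) ⟩
        length (filter P? xs) + length (filter (∁? P?) xs) ∎))
    where open ≤-Reasoning

  pigeonhole-sum : (f : A → ℕ) {D : ℕ} (xs : List A) → 0 < length xs →
                   length xs * D ≤ sum (map f xs) → ∃ λ x → D ≤ f x
  pigeonhole-sum f {D} (x ∷ xs) _ h with D ≤? f x
  ... | yes D≤fx = x , D≤fx
  pigeonhole-sum f {D} (x ∷ []) _ h | no D≰fx =
    contradiction (subst₂ _≤_ (+-identityʳ D) (+-identityʳ (f x)) h) D≰fx
  pigeonhole-sum f {D} (x ∷ y ∷ xs) _ h | no D≰fx =
    pigeonhole-sum f (y ∷ xs) (s≤s z≤n)
      (+-cancelˡ-≤ D _ _ (≤-trans h (+-monoˡ-≤ _ (<⇒≤ (≰⇒> D≰fx)))))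

  sum-indicator : (g : A → Bool) (xs : List A) →
                  sum (map (λ x → if g x then 1 else 0) xs) ≡ length (filter (T? ∘ g) xs)
  sum-indicator g [] = refl
  sum-indicator g (x ∷ xs) with g x
  ... | true  = cong suc (sum-indicator g xs)
  ... | false = sum-indicator g xs

  length-filter-≢ : (_≟_ : DecidableEquality A) (x : A) {xs : List A} → Unique xs →
                    length xs ≤ suc (length (filter (¬? ∘ (x ≟_)) xs))
  length-filter-≢ _≟_ x {[]} [] = z≤n
  length-filter-≢ _≟_ x {y ∷ ys} (y∉ys ∷ u) with x ≟ y
  ... | yes refl = s≤s (≤-reflexive (sym (cong length (filter-all (¬? ∘ (x ≟_)) y∉ys))))
  ... | no _     = s≤s (length-filter-≢ _≟_ x u)

  AllPairs-resp-⊇ : {R : A → A → Set} {xs ys : List A} → ys ⊆ xs → AllPairs R xs → AllPairs R ys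
  AllPairs-resp-⊇ []         []       = []
  AllPairs-resp-⊇ (_ ∷ʳ ys⊆) (_ ∷ rs) = AllPairs-resp-⊇ ys⊆ rs
  AllPairs-resp-⊇ (refl ∷ ys⊆) (r ∷ rs) = All-resp-⊆ ys⊆ r ∷ AllPairs-resp-⊇ ys⊆ rs

  lookup-AllPairs : {R : A → A → Set} → B.Symmetric R → {xs : List A} → AllPairs R xs →
                    {i j : Fin (length xs)} → i ≢ j → R (lookup xs i) (lookup xs j)
  lookup-AllPairs sym (r ∷ rs) {Fin.zero}  {Fin.zero}  i≢j = contradiction refl i≢j
  lookup-AllPairs sym (r ∷ rs) {Fin.zero}  {Fin.suc j} _   = All.lookup r (∈-lookup j)
  lookup-AllPairs sym (r ∷ rs) {Fin.suc i} {Fin.zero}  _   = sym (All.lookup r (∈-lookup i))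
  lookup-AllPairs sym (r ∷ rs) {Fin.suc i} {Fin.suc j} i≢j = lookup-AllPairs sym rs (i≢j ∘ cong Fin.suc)

  lookup-inject≤-injective : {xs : List A} {k : ℕ} → Unique xs → (k≤ : k ≤ length xs) →
                             Injective _≡_ _≡_ (λ i → lookup xs (inject≤ i k≤))
  lookup-inject≤-injective u k≤ {i} {j} eq with inject≤ i k≤ ≟ᶠ inject≤ j k≤
  ... | yes e = inject≤-injective k≤ k≤ i j e
  ... | no ne = contradiction eq (lookup-AllPairs ≢-sym u ne)

module _ {m : ℕ} (d : BipColoring m) (t : ℕ) where

  MonoBlock : Bool → ℕ → List (Fin m) → List (Fin m) → Set
  MonoBlock κ a Ls Rs = Σ (List (Fin m)) λ Ls′ → Σ (List (Fin m)) λ Rs′ →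
    Ls′ ⊆ Ls × Rs′ ⊆ Rs × t ≤ length Ls′ × a ≤ length Rs′ ×
    All (λ x → All (λ y → d x y ≡ κ) Rs′) Ls′

  MonoBlock-resp-⊆ : ∀ {κ a Ls₁ Ls₂ Rs₁ Rs₂} → Ls₁ ⊆ Ls₂ → Rs₁ ⊆ Rs₂ →
                     MonoBlock κ a Ls₁ Rs₁ → MonoBlock κ a Ls₂ Rs₂
  MonoBlock-resp-⊆ L⊆ R⊆ (Ls′ , Rs′ , L′⊆ , R′⊆ , hL , hR , mono) =
    Ls′ , Rs′ , ⊆-trans L′⊆ L⊆ , ⊆-trans R′⊆ R⊆ , hL , hR , mono

  MonoBlock-∷ : ∀ {κ a Ls Rs} (y : Fin m) → All (λ x → d x y ≡ κ) Ls →
                MonoBlock κ a Ls Rs → MonoBlock κ (suc a) Ls (y ∷ Rs)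
  MonoBlock-∷ y col (Ls′ , Rs′ , L′⊆ , R′⊆ , hL , hR , mono) =
    Ls′ , y ∷ Rs′ , L′⊆ , refl ∷ R′⊆ , hL , s≤s hR ,
    All.zipWith (λ (e , es) → e ∷ es) (All-resp-⊆ L′⊆ col , mono)

  t*2^-split : (a b : ℕ) → t * 2 ^ (suc a + suc b) ≡ t * 2 ^ (a + suc b) + t * 2 ^ (suc a + b)
  t*2^-split a b = begin
    t * (x + (x + 0))   ≡⟨ cong (λ y → t * (x + y)) (+-identityʳ x) ⟩
    t * (x + x)         ≡⟨ *-distribˡ-+ t x x ⟩
    t * x + t * x       ≡⟨ cong (λ k → t * x + t * 2 ^ k) (+-suc a b) ⟩
    t * x + t * 2 ^ (suc a + b) ∎
    where
    open ≡-Reasoning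
    x = 2 ^ (a + suc b)

  red? : (y : Fin m) → Decidable (λ x → d x y ≡ true)
  red? y x = d x y ≟ᵇ true

  t≤t*2^ : ∀ k → t ≤ t * 2 ^ k
  t≤t*2^ k = m≤m*n t (2 ^ k) {{>-nonZero (m^n>0 2 k)}}

  monoBlock : (a b : ℕ) (Ls Rs : List (Fin m)) → t * 2 ^ (a + b) ≤ length Ls → a + b ≤ length Rs →
              MonoBlock true a Ls Rs ⊎ MonoBlock false b Ls Rs
  monoBlock zero b Ls Rs hL _ =
    inj₁ (Ls , [] , ⊆-refl , minimum Rs , ≤-trans (t≤t*2^ b) hL , z≤n , All.tabulate (λ _ → []))
  monoBlock (suc a) zero Ls Rs hL _ =
    inj₂ (Ls , [] , ⊆-refl , minimum Rs , ≤-trans (t≤t*2^ (suc a + 0)) hL , z≤n , All.tabulate (λ _ → []))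
  monoBlock (suc a) (suc b) Ls (y ∷ Rs) hL (s≤s hR)
    with pigeonhole-filter (red? y) Ls (subst (_≤ length Ls) (t*2^-split a b) hL)
  ... | inj₂ large with monoBlock a (suc b) (filter (red? y) Ls) Rs (<⇒≤ large) hR
  ...   | inj₁ blk = inj₁ (MonoBlock-resp-⊆ (filter-⊆ _ Ls) ⊆-refl (MonoBlock-∷ y (all-filter _ Ls) blk))
  ...   | inj₂ blk = inj₂ (MonoBlock-resp-⊆ (filter-⊆ _ Ls) (y ∷ʳ ⊆-refl) blk)
  monoBlock (suc a) (suc b) Ls (y ∷ Rs) hL (s≤s hR) | inj₁ large
    with monoBlock (suc a) b (filter (∁? (red? y)) Ls) Rs large (subst (_≤ length Rs) (+-suc a b) hR)
  ...   | inj₁ blk = inj₁ (MonoBlock-resp-⊆ (filter-⊆ _ Ls) (y ∷ʳ ⊆-refl) blk)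
  ...   | inj₂ blk = inj₂ (MonoBlock-resp-⊆ (filter-⊆ _ Ls) ⊆-refl
                       (MonoBlock-∷ y (All.map ¬-not (all-filter _ Ls)) blk))

  MonoBlock⇒HasMonoKtt : ∀ {κ} → MonoBlock κ t (allFin m) (allFin m) → HasMonoKtt t d
  MonoBlock⇒HasMonoKtt {κ} (Ls , Rs , L⊆ , R⊆ , hL , hR , mono) =
    κ , left , right ,
    lookup-inject≤-injective (AllPairs-resp-⊇ L⊆ (allFin⁺ m)) hL ,
    lookup-inject≤-injective (AllPairs-resp-⊇ R⊆ (allFin⁺ m)) hR ,
    λ a b → All.lookup (All.lookup mono (∈-lookup _)) (∈-lookup _)
    where
    left right : Fin t → Fin m
    left i = lookup Ls (inject≤ i hL)
    right i = lookup Rs (inject≤ i hR)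

bipartiteRamseyBound : ℕ → ℕ
bipartiteRamseyBound t = t * 2 ^ (t + t) + (t + t)

t≤bipartiteRamseyBound : (t : ℕ) → t ≤ bipartiteRamseyBound t
t≤bipartiteRamseyBound t = ≤-trans (m≤m+n t t) (m≤n+m (t + t) (t * 2 ^ (t + t)))

bipartiteRamsey : (t : ℕ) → BRProperty t (bipartiteRamseyBound t)
bipartiteRamsey t m bound≤m d
  with monoBlock d t t t (allFin m) (allFin m) (≤-length (m≤m+n _ _)) (≤-length (m≤n+m (t + t) (t * 2 ^ (t + t))))
  where
  ≤-length : ∀ {k} → k ≤ bipartiteRamseyBound t → k ≤ length (allFin m)
  ≤-length k≤ = subst (_ ≤_) (sym (length-allFin m)) (≤-trans k≤ bound≤m)
... | inj₁ blk = MonoBlock⇒HasMonoKtt d t blk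
... | inj₂ blk = MonoBlock⇒HasMonoKtt d t blk

ramseyBound : ℕ → ℕ → ℕ
ramseyBound zero    b       = 0
ramseyBound (suc a) zero    = 0
ramseyBound (suc a) (suc b) = suc (ramseyBound a (suc b) + ramseyBound (suc a) b)

starConstant : ℕ → ℕ
starConstant s = ramseyBound (suc (s * s)) s + ramseyBound s s

module _ {n : ℕ} (c : Coloring n) (symm : Symmetric c) where

  MonoEdge : Bool → Rel (Fin n) 0ℓ
  MonoEdge κ x y = x ≢ y × c x y ≡ κ

  MonoEdge-sym : ∀ {κ} → B.Symmetric (MonoEdge κ)
  MonoEdge-sym (x≢y , e) = ≢-sym x≢y , trans (symm _ _) e

  Clique : Bool → List (Fin n) → Set
  Clique κ = AllPairs (MonoEdge κ)

  HasClique : Bool → ℕ → List (Fin n) → Set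
  HasClique κ k xs = Σ (List (Fin n)) λ ys → ys ⊆ xs × length ys ≡ k × Clique κ ys

  InducedMonoStar : ℕ → Set
  InducedMonoStar s = Σ Bool λ κ → Σ (Fin n) λ u → Σ (List (Fin n)) λ ys →
    s ≤ length ys × All (MonoEdge κ u) ys × Clique (not κ) ys

  InducedMonoStar⇒InducedMono-Star : ∀ {s m} → InducedMonoStar s → m ≤ s → InducedMono c (Star m)
  InducedMonoStar⇒InducedMono-Star {m = m} (κ , u , ys , s≤ , spokes , clique) m≤s =
    κ , f , f-injective , f-colour
    where
    m≤ = ≤-trans m≤s s≤
    leaf : Fin m → Fin n
    leaf i = lookup ys (inject≤ i m≤)
    spoke : ∀ i → MonoEdge κ u (leaf i)
    spoke i = All.lookup spokes (∈-lookup _)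
    f : Fin (suc m) → Fin n
    f Fin.zero = u
    f (Fin.suc i) = leaf i
    f-injective : Injective _≡_ _≡_ f
    f-injective {Fin.zero}  {Fin.zero}  _  = refl
    f-injective {Fin.zero}  {Fin.suc j} eq = contradiction eq (proj₁ (spoke j))
    f-injective {Fin.suc i} {Fin.zero}  eq = contradiction (sym eq) (proj₁ (spoke i))
    f-injective {Fin.suc i} {Fin.suc j} eq =
      cong Fin.suc (lookup-inject≤-injective (AllPairs.map proj₁ clique) m≤ eq)
    f-colour : ∀ a b → a ≢ b → c (f a) (f b) ≡ (if Star m a b then κ else not κ)
    f-colour Fin.zero    Fin.zero    a≢b = contradiction refl a≢b
    f-colour Fin.zero    (Fin.suc j) _   = proj₂ (spoke j)
    f-colour (Fin.suc i) Fin.zero    _   = proj₂ (MonoEdge-sym (spoke i))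
    f-colour (Fin.suc i) (Fin.suc j) a≢b =
      proj₂ (lookup-AllPairs MonoEdge-sym clique (a≢b ∘ cong Fin.suc ∘ inject≤-injective m≤ m≤ i j))

  coloured? : (κ : Bool) (v : Fin n) → Decidable (λ x → c v x ≡ κ)
  coloured? κ v x = c v x ≟ᵇ κ

  _≢?_ : (v : Fin n) → Decidable (v ≢_)
  v ≢? x = ¬? (v ≟ᶠ x)

  spokes-⊆ : ∀ {κ v xs ys zs} → ys ⊆ zs → zs ⊆ xs → All (v ≢_) xs →
             All (λ x → c v x ≡ κ) zs → All (MonoEdge κ v) ys
  spokes-⊆ ys⊆ zs⊆ v∉ col = All.zip (All-resp-⊆ (⊆-trans ys⊆ zs⊆) v∉ , All-resp-⊆ ys⊆ col)

  ramsey : (κ : Bool) (a b : ℕ) (xs : List (Fin n)) → Unique xs → ramseyBound a b ≤ length xs →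
           HasClique κ a xs ⊎ HasClique (not κ) b xs
  ramsey κ zero    b       xs _ _ = inj₁ ([] , minimum xs , refl , [])
  ramsey κ (suc a) zero    xs _ _ = inj₂ ([] , minimum xs , refl , [])
  ramsey κ (suc a) (suc b) (v ∷ rest) (v∉rest ∷ u) (s≤s h)
    with pigeonhole-filter (coloured? κ v) rest h
  ... | inj₂ large with ramsey κ a (suc b) (filter (coloured? κ v) rest) (AllPairs.filter⁺ _ u) (<⇒≤ large)
  ...   | inj₁ (ys , ys⊆ , len , cl) =
          inj₁ (v ∷ ys , refl ∷ ⊆-trans ys⊆ (filter-⊆ _ rest) , cong suc len ,
                spokes-⊆ ys⊆ (filter-⊆ _ rest) v∉rest (all-filter _ rest) ∷ cl)
  ...   | inj₂ (ys , ys⊆ , len , cl) = inj₂ (ys , v ∷ʳ ⊆-trans ys⊆ (filter-⊆ _ rest) , len , cl)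
  ramsey κ (suc a) (suc b) (v ∷ rest) (v∉rest ∷ u) (s≤s h) | inj₁ large
    with ramsey κ (suc a) b (filter (∁? (coloured? κ v)) rest) (AllPairs.filter⁺ _ u) large
  ...   | inj₁ (ys , ys⊆ , len , cl) = inj₁ (ys , v ∷ʳ ⊆-trans ys⊆ (filter-⊆ _ rest) , len , cl)
  ...   | inj₂ (ys , ys⊆ , len , cl) =
          inj₂ (v ∷ ys , refl ∷ ⊆-trans ys⊆ (filter-⊆ _ rest) , cong suc len ,
                spokes-⊆ ys⊆ (filter-⊆ _ rest) v∉rest (All.map ¬-not (all-filter _ rest)) ∷ cl)

  -- numEdges c κ unfolds to the sum of degree κ i over all i; only the
  -- neighbours j of i with i < j are counted.
  isEdge : Bool → Fin n → Fin n → Bool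
  isEdge κ i j = (toℕ i <ᵇ toℕ j) ∧ (if κ then c i j else not (c i j))

  degree : Bool → Fin n → ℕ
  degree κ i = sum (map (λ j → if isEdge κ i j then 1 else 0) (allFin n))

  T-isEdge : ∀ κ i {j} → T (isEdge κ i j) → MonoEdge κ i j
  T-isEdge κ i {j} e with Equivalence.to T-∧ e
  ... | i<j , col = (λ { refl → <-irrefl refl (<ᵇ⇒< (toℕ i) (toℕ i) i<j) }) , T-colour κ (c i j) col
    where
    T-colour : ∀ κ b → T (if κ then b else not b) → b ≡ κ
    T-colour true  true  _ = refl
    T-colour false false _ = refl

  heavy-vertex : (κ : Bool) {D : ℕ} → 0 < n → D * n ≤ numEdges c κ →
                 Σ (Fin n) λ i → Σ (List (Fin n)) λ ys →
                   Unique ys × D ≤ length ys × All (MonoEdge κ i) ys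
  heavy-vertex κ {D} n>0 h
    with pigeonhole-sum (degree κ) (allFin n) (subst (0 <_) (sym (length-allFin n)) n>0)
           (subst (_≤ numEdges c κ) (trans (*-comm D n) (cong (_* D) (sym (length-allFin n)))) h)
  ... | i , D≤ = i , filter (T? ∘ isEdge κ i) (allFin n) , AllPairs.filter⁺ _ (allFin⁺ n) ,
                 subst (D ≤_) (sum-indicator (isEdge κ i) (allFin n)) D≤ ,
                 All.map (T-isEdge κ i) (all-filter _ (allFin n))

  star-or-clique : (κ : Bool) (a s : ℕ) {D : ℕ} → 0 < n → ramseyBound a s ≤ D → D * n ≤ numEdges c κ →
                   InducedMonoStar s ⊎ ∃ λ K → length K ≡ a × Clique κ K
  star-or-clique κ a s n>0 R≤D h with heavy-vertex κ n>0 h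
  ... | i , ys , u , D≤ , spokes with ramsey κ a s ys u (≤-trans R≤D D≤)
  ...   | inj₁ (K , _ , lenK , cl) = inj₂ (K , lenK , cl)
  ...   | inj₂ (L , L⊆ , lenL , cl) = inj₁ (κ , i , L , ≤-reflexive (sym lenL) , All-resp-⊆ L⊆ spokes , cl)

  neighbours nonNeighbours : Bool → Fin n → List (Fin n) → List (Fin n)
  neighbours    κ q K = filter (coloured? κ q) (filter (q ≢?_) K)
  nonNeighbours κ q K = filter (∁? (coloured? κ q)) (filter (q ≢?_) K)

  nonNeighbours-spokes : ∀ κ q K → All (MonoEdge (not κ) q) (nonNeighbours κ q K)
  nonNeighbours-spokes κ q K =
    spokes-⊆ ⊆-refl (filter-⊆ _ (filter (q ≢?_) K)) (all-filter (q ≢?_) K)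
      (All.map ¬-not (all-filter _ (filter (q ≢?_) K)))

  ∈-neighbours⁻ : ∀ {κ q K u} → u ∈ neighbours κ q K → u ∈ K × MonoEdge κ u q
  ∈-neighbours⁻ {κ} {q} {K} {u} u∈ with ∈-filter⁻ (coloured? κ q) u∈
  ... | u∈K₁ , cqu with ∈-filter⁻ (q ≢?_) u∈K₁
  ...   | u∈K , q≢u = u∈K , MonoEdge-sym (q≢u , cqu)

  common-neighbour-or-star : (κ : Bool) (s : ℕ) (Q K : List (Fin n)) → Clique κ K →
                             length Q * s < length K →
                             InducedMonoStar s ⊎ ∃ λ u → u ∈ K × All (MonoEdge κ u) Q
  common-neighbour-or-star κ s [] (u ∷ K) _ _ = inj₂ (u , here refl , [])
  common-neighbour-or-star κ s (q ∷ Q) K cl h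
    with pigeonhole-filter (coloured? κ q) (filter (q ≢?_) K)
           (subst (_≤ length (filter (q ≢?_) K)) (+-comm s (length Q * s))
             (≤-pred (≤-trans h (length-filter-≢ _≟ᶠ_ q (AllPairs.map proj₁ cl)))))
  ... | inj₁ s≤B =
        inj₁ (not κ , q , nonNeighbours κ q K , s≤B , nonNeighbours-spokes κ q K ,
              subst (λ κ′ → Clique κ′ (nonNeighbours κ q K)) (sym (not-involutive κ))
                (AllPairs.filter⁺ _ (AllPairs.filter⁺ _ cl)))
  ... | inj₂ large
    with common-neighbour-or-star κ s Q (neighbours κ q K) (AllPairs.filter⁺ _ (AllPairs.filter⁺ _ cl)) large
  ...   | inj₁ star = inj₁ star
  ...   | inj₂ (u , u∈ , spokes) with ∈-neighbours⁻ u∈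
  ...     | u∈K , uq = inj₂ (u , u∈K , uq ∷ spokes)

  inducedMonoStar : (s : ℕ) → 0 < n → starConstant s * n ≤ eR c → starConstant s * n ≤ eB c →
                    InducedMonoStar s
  inducedMonoStar s n>0 hR hB
    with star-or-clique true (suc (s * s)) s n>0 (m≤m+n _ _) hR
       | star-or-clique false s s n>0 (m≤n+m _ (ramseyBound (suc (s * s)) s)) hB
  ... | inj₁ star | _         = star
  ... | inj₂ _    | inj₁ star = star
  ... | inj₂ (K , lenK , red) | inj₂ (Q , lenQ , blue)
    with common-neighbour-or-star true s Q K red (subst₂ (λ q k → q * s < k) (sym lenQ) (sym lenK) ≤-refl)
  ...   | inj₁ star = star
  ...   | inj₂ (u , _ , spokes) = true , u , Q , ≤-reflexive (sym lenQ) , spokes , blue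

corollary2p4 : (t : ℕ) → 2 ≤ t →
    Σ ℕ λ C → Σ ℕ λ N → ∀ (n : ℕ) → N ≤ n →
    (c : Coloring n) → Symmetric c →
    C * n ≤ eR c → C * n ≤ eB c →
    (∀ (b : ℕ) → IsBR t b →
    InducedMono c (Star b) ⊎ InducedMono c (Split t))
    × InducedMono c (Star t)
corollary2p4 t _ = starConstant s , 1 , λ n n>0 c symm hR hB →
  let star = inducedMonoStar c symm s n>0 hR hB in
  (λ b isBR → inj₁ (InducedMonoStar⇒InducedMono-Star c symm star (proj₂ isBR s (bipartiteRamsey t)))) ,
  InducedMonoStar⇒InducedMono-Star c symm star (t≤bipartiteRamseyBound t)
  where
  s = bipartiteRamseyBound t
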